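{- For $n\ge 2$ and $2\le k\le n-1$, the number $t_{n,k}$ of strongly increasing Schröder trees with $n$ leaves whose root has exactly $k$ children equals \[ t_{n,k}=n!\,\frac{k}{(k+1)!}. \]
   Context: A Schröder tree is a rooted plane tree (children of each node are ordered) in which every internal node has at least two children; its size is its number of leaves. A strongly increasing Schröder tree is a Schröder tree whose internal nodes carry labels such that, if there are $\ell$ internal nodes, the labels are exactly $1,\dots,\ell$, each used once, and labels strictly increase along every path from the root to a leaf. Leaves are unlabeled. -}

module Defs where

open import Data.Nat using (ℕ; zero; suc; _+_; _≤_; _<_)
open import Data.List using (List; []; _∷_; _++_; length; map; upTo)
open import Data.List.Relation.Unary.All using (All)
open import Data.List.Relation.Unary.Unique.Propositional using (Unique)
open import Data.List.Membership.Propositional using (_∈_)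
open import Data.List.Relation.Binary.Permutation.Propositional using (_↭_)
open import Data.Product using (Σ; _×_)
open import Data.Unit using (⊤)
open import Function.Bundles using (_⇔_)
open import Relation.Binary.PropositionalEquality using (_≡_)

data Tree : Set where
  leaf : Tree
  node : ℕ → List Tree → Tree

leaves  : Tree → ℕ
leavesL : List Tree → ℕ
leaves leaf = 1
leaves (node _ ts) = leavesL ts
leavesL [] = 0
leavesL (t ∷ ts) = leaves t + leavesL ts

labels  : Tree → List ℕ
labelsL : List Tree → List ℕ
labels leaf = []
labels (node l ts) = l ∷ labelsL ts
labelsL [] = []
labelsL (t ∷ ts) = labels t ++ labelsL ts

rootDegree : Tree → ℕ
rootDegree leaf = 0
rootDegree (node _ ts) = length ts

data Schroder : Tree → Set where
  leaf : Schroder leaf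
  node : ∀ {l ts} → 2 ≤ length ts → All Schroder ts → Schroder (node l ts)

LabelAbove : ℕ → Tree → Set
LabelAbove l leaf = ⊤
LabelAbove l (node m _) = l < m

data Increasing : Tree → Set where
  leaf : Increasing leaf
  node : ∀ {l ts} → All (LabelAbove l) ts → All Increasing ts → Increasing (node l ts)

LabelsOneToL : Tree → Set
LabelsOneToL t = labels t ↭ map suc (upTo (length (labels t)))

StronglyIncreasingSchroder : Tree → Set
StronglyIncreasingSchroder t = Schroder t × Increasing t × LabelsOneToL t

HasCount : (Tree → Set) → ℕ → Set
HasCount P m = Σ (List Tree) λ L → Unique L × (∀ t → (t ∈ L) ⇔ P t) × length L ≡ m

SISTree : ℕ → ℕ → Tree → Set
SISTree n k t = StronglyIncreasingSchroder t × leaves t ≡ n × rootDegree t ≡ k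

module Submission where

-- The identity t_{n,k} · (k+1)! = n! · k comes from a bijective recursion on
-- strongly increasing Schröder (SIS) trees.  An SIS tree t with largest label
-- ℓ has leaves t + 1 children: t with an extra leaf below the node ℓ, and, for
-- each leaf, t with that leaf replaced by a new node ℓ + 1 carrying two
-- leaves.  Each child is an SIS tree with one leaf more, and keeps the root
-- degree unless t is flat (its root is its only internal node).  Conversely,
-- removing a leaf below the largest label of a non-flat SIS tree u produces
-- the unique tree of which u is a child.
--
-- Generation j of
-- the flat tree with k leaves then lists the SIS trees with k + 1 + j leaves
-- and root degree k exactly once; its size is k · (k+2) ⋯ (k+1+j).

open import Defs
open import Data.Nat using (ℕ; zero; suc; _+_; _*_; _≤_; _<_; _!; z≤n; s≤s; _≟_)
open import Data.Nat.Properties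
  using (1+n≢n; m≢1+m+n; +-suc; suc-injective; ≤-refl; ≤-trans; +-identityʳ;
         *-comm; *-assoc; m≤n⇒∃[o]m+o≡n; <-irrefl; <⇒≤; +-mono-≤; n≤1+n)
open import Data.List using (List; []; _∷_; _++_; length; map; upTo; replicate; [_]; concatMap)
import Data.List.Properties as LP
open import Data.List.Relation.Unary.All as All using (All; []; _∷_)
import Data.List.Relation.Unary.All.Properties as AllP
open import Data.List.Relation.Unary.Any using (here; there)
open import Data.List.Relation.Unary.AllPairs using ([]; _∷_)
open import Data.List.Relation.Unary.Unique.Propositional using (Unique)
import Data.List.Relation.Unary.Unique.Propositional.Properties as UP
open import Data.List.Membership.Propositional using (_∈_; _∉_; find; lose)
import Data.List.Membership.Propositional.Properties as MP
open import Data.List.Relation.Binary.Permutation.Propositional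
  using (_↭_; prep; swap; ↭-refl; ↭-trans; ↭-sym; ↭⇒↭ₛ)
import Data.List.Relation.Binary.Permutation.Propositional.Properties as PP
import Data.List.Relation.Binary.Permutation.Setoid.Properties as PermSetoid
open import Data.Product using (Σ; _×_; _,_; proj₁; proj₂)
open import Data.Sum using (_⊎_; inj₁; inj₂)
open import Data.Empty using (⊥-elim)
open import Data.Unit using (tt)
open import Relation.Nullary using (¬_; yes; no)
open import Relation.Binary.PropositionalEquality hiding ([_])
open import Function.Bundles using (mk⇔)

unique-resp-↭ : ∀ {A : Set} {xs ys : List A} → xs ↭ ys → Unique xs → Unique ys
unique-resp-↭ {A} p = PermSetoid.Unique-resp-↭ (setoid A) (↭⇒↭ₛ p)

unique-++⁻ : ∀ {A : Set} {xs ys : List A} → Unique (xs ++ ys) →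
  Unique xs × Unique ys × (∀ {v} → v ∈ xs → v ∉ ys)
unique-++⁻ {xs = []} u = [] , u , λ ()
unique-++⁻ {xs = x ∷ xs} (x∉ ∷ u) with unique-++⁻ {xs = xs} u
... | uxs , uys , disjoint =
  AllP.++⁻ˡ xs x∉ ∷ uxs , uys ,
  λ { (here refl) q → All.lookup (AllP.++⁻ʳ xs x∉) q refl ; (there p) → disjoint p }

length-concatMap : ∀ {A B : Set} (f : A → List B) xs c →
  (∀ {x} → x ∈ xs → length (f x) ≡ c) → length (concatMap f xs) ≡ length xs * c
length-concatMap f [] c same = refl
length-concatMap f (x ∷ xs) c same =
  trans (LP.length-++ (f x))
        (cong₂ _+_ (same (here refl)) (length-concatMap f xs c (λ p → same (there p))))

unique-concatMap : ∀ {A B : Set} (P : A → Set) (f : A → List B) (g : B → A) xs →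
  Unique xs → All P xs → (∀ {x} → P x → Unique (f x)) →
  (∀ {x u} → P x → u ∈ f x → g u ≡ x) → Unique (concatMap f xs)
unique-concatMap P f g [] _ _ _ _ = []
unique-concatMap P f g (x ∷ xs) (x∉ ∷ u) (px ∷ pxs) unique-f g-inv =
  UP.++⁺ (unique-f px) (unique-concatMap P f g xs u pxs unique-f g-inv) disjoint
  where
    disjoint : ∀ {v} → ¬ (v ∈ f x × v ∈ concatMap f xs)
    disjoint (p , q) with find (MP.∈-concatMap⁻ f q)
    ... | y , y∈xs , r = All.lookup x∉ y∈xs (trans (sym (g-inv px p)) (g-inv (All.lookup pxs y∈xs) r))

OneTo : List ℕ → Set
OneTo xs = xs ↭ map suc (upTo (length xs))

upTo-suc-↭ : ∀ n → map suc (upTo (suc n)) ↭ suc n ∷ map suc (upTo n)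
upTo-suc-↭ n = subst (_↭ suc n ∷ map suc (upTo n))
  (trans (sym (LP.map-++ suc (upTo n) [ n ])) (cong (map suc) (LP.upTo-∷ʳ n)))
  (↭-sym (PP.∷↭∷ʳ (suc n) (map suc (upTo n))))

oneTo-unique : ∀ {xs} → OneTo xs → Unique xs
oneTo-unique {xs} p = unique-resp-↭ (↭-sym p) (UP.map⁺ suc-injective (UP.upTo⁺ (length xs)))

oneTo-bounded : ∀ {xs} → OneTo xs → All (_≤ length xs) xs
oneTo-bounded {xs} p = PP.All-resp-↭ (↭-sym p) (AllP.map⁺ (AllP.all-upTo (length xs)))

oneTo-max : ∀ {x xs} → OneTo (x ∷ xs) → suc (length xs) ∈ x ∷ xs
oneTo-max p = PP.∈-resp-↭ (↭-sym p) (MP.∈-map⁺ suc (MP.∈-upTo⁺ ≤-refl))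

oneTo-fresh : ∀ {xs} → OneTo xs → suc (length xs) ∉ xs
oneTo-fresh p q = <-irrefl refl (All.lookup (oneTo-bounded p) q)

oneTo-add-next : ∀ {xs ys} → ys ↭ suc (length xs) ∷ xs → OneTo xs → OneTo ys
oneTo-add-next {xs} {ys} p o =
  subst (λ z → ys ↭ map suc (upTo z)) (sym (PP.↭-length p))
        (↭-trans p (↭-trans (prep _ o) (↭-sym (upTo-suc-↭ (length xs)))))

oneTo-remove-max : ∀ {xs ys} → ys ↭ length ys ∷ xs → OneTo ys → OneTo xs
oneTo-remove-max {xs} {ys} p o =
  PP.drop-∷ (↭-trans (↭-sym p') (↭-trans o' (upTo-suc-↭ (length xs))))
  where
    len : length ys ≡ suc (length xs)
    len = PP.↭-length p
    p' : ys ↭ suc (length xs) ∷ xs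
    p' = subst (λ z → ys ↭ z ∷ xs) len p
    o' : ys ↭ map suc (upTo (suc (length xs)))
    o' = subst (λ z → ys ↭ map suc (upTo z)) len o

leaves-positive : ∀ t → Schroder t → 1 ≤ leaves t
length≤leavesL : ∀ ts → All Schroder ts → length ts ≤ leavesL ts
leaves-positive leaf _ = s≤s z≤n
leaves-positive (node l ts) (node two s) = ≤-trans (<⇒≤ two) (length≤leavesL ts s)
length≤leavesL [] [] = z≤n
length≤leavesL (t ∷ ts) (s ∷ ss) = +-mono-≤ (leaves-positive t s) (length≤leavesL ts ss)

leafForest-leaves : ∀ ts → All (_≡ leaf) ts → leavesL ts ≡ length ts
leafForest-leaves [] [] = refl
leafForest-leaves (.leaf ∷ ts) (refl ∷ e) = cong suc (leafForest-leaves ts e)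

leavesL≡length⇒leafForest : ∀ ts → All Schroder ts → leavesL ts ≡ length ts →
  ts ≡ replicate (length ts) leaf
leavesL≡length⇒leafForest [] [] e = refl
leavesL≡length⇒leafForest (leaf ∷ ts) (_ ∷ ss) e =
  cong (leaf ∷_) (leavesL≡length⇒leafForest ts ss (suc-injective e))
leavesL≡length⇒leafForest (node l cs ∷ ts) (node two s ∷ ss) e =
  ⊥-elim (<-irrefl refl (subst (2 + length ts ≤_) e
    (+-mono-≤ (≤-trans two (length≤leavesL cs s)) (length≤leavesL ts ss))))

-- In an increasing tree all of whose labels are ≤ M, the children of the node
-- labelled M are leaves: a child node would carry a label above M.
children-of-max : ∀ {M} ts → All (LabelAbove M) ts → All (_≤ M) (labelsL ts) → All (_≡ leaf) ts
children-of-max [] [] _ = []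
children-of-max (leaf ∷ ts) (_ ∷ above) bounded = refl ∷ children-of-max ts above bounded
children-of-max (node m cs ∷ ts) (M<m ∷ _) (m≤M ∷ _) = ⊥-elim (<-irrefl refl (≤-trans M<m m≤M))

flat : ℕ → Tree
flat k = node 1 (replicate k leaf)

labelsL-leaves : ∀ k → labelsL (replicate k leaf) ≡ []
labelsL-leaves zero = refl
labelsL-leaves (suc k) = labelsL-leaves k

leavesL-leaves : ∀ k → leavesL (replicate k leaf) ≡ k
leavesL-leaves k = trans (leafForest-leaves _ (AllP.replicate⁺ k refl)) (LP.length-replicate k)

flat-SIS : ∀ k → 2 ≤ k → StronglyIncreasingSchroder (flat k)
flat-SIS k two =
  node (subst (2 ≤_) (sym (LP.length-replicate k)) two) (AllP.replicate⁺ k leaf) ,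
  node (AllP.replicate⁺ k tt) (AllP.replicate⁺ k leaf) ,
  subst OneTo (cong (1 ∷_) (sym (labelsL-leaves k))) ↭-refl

SIS-flat : ∀ r ts → StronglyIncreasingSchroder (node r ts) → leavesL ts ≡ length ts →
  node r ts ≡ flat (length ts)
SIS-flat r ts (node _ s , _ , o) e = cong₂ node r≡1 leafForest
  where
    leafForest : ts ≡ replicate (length ts) leaf
    leafForest = leavesL≡length⇒leafForest ts s e
    onlyRoot : OneTo (r ∷ [])
    onlyRoot = subst (λ z → OneTo (r ∷ z))
      (trans (cong labelsL leafForest) (labelsL-leaves (length ts))) o
    r≡1 : r ≡ 1
    r≡1 = LP.∷-injectiveˡ (PP.↭-singleton-inv onlyRoot)

-- The root of a non-flat SIS tree does not carry the maximal label, since the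
-- children of the maximal node are leaves.
root-not-max : ∀ r ts → StronglyIncreasingSchroder (node r ts) → leavesL ts ≢ length ts →
  r ≢ suc (length (labelsL ts))
root-not-max r ts (_ , node above _ , o) nonflat refl =
  nonflat (leafForest-leaves ts (children-of-max ts above (All.tail (oneTo-bounded o))))

-- Splitting a leaf.

data Split (m : ℕ) : Tree → Tree → Set
data SplitL (m : ℕ) : List Tree → List Tree → Set
data Split m where
  at-leaf : Split m leaf (node m (leaf ∷ leaf ∷ []))
  inside  : ∀ {l ts us} → SplitL m ts us → Split m (node l ts) (node l us)
data SplitL m where
  in-head : ∀ {t u ts} → Split m t u → SplitL m (t ∷ ts) (u ∷ ts)
  in-tail : ∀ {t ts us} → SplitL m ts us → SplitL m (t ∷ ts) (t ∷ us)

leafSplits  : ℕ → Tree → List Tree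
leafSplitsL : ℕ → List Tree → List (List Tree)
leafSplits m leaf = [ node m (leaf ∷ leaf ∷ []) ]
leafSplits m (node l ts) = map (node l) (leafSplitsL m ts)
leafSplitsL m [] = []
leafSplitsL m (t ∷ ts) = map (_∷ ts) (leafSplits m t) ++ map (t ∷_) (leafSplitsL m ts)

leafSplits-sound  : ∀ m t {u} → u ∈ leafSplits m t → Split m t u
leafSplitsL-sound : ∀ m ts {us} → us ∈ leafSplitsL m ts → SplitL m ts us
leafSplits-sound m leaf (here refl) = at-leaf
leafSplits-sound m (node l ts) p with MP.∈-map⁻ (node l) p
... | us , q , refl = inside (leafSplitsL-sound m ts q)
leafSplitsL-sound m (t ∷ ts) p with MP.∈-++⁻ (map (_∷ ts) (leafSplits m t)) p
... | inj₁ q with MP.∈-map⁻ (_∷ ts) q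
...   | u , r , refl = in-head (leafSplits-sound m t r)
leafSplitsL-sound m (t ∷ ts) p | inj₂ q with MP.∈-map⁻ (t ∷_) q
...   | us , r , refl = in-tail (leafSplitsL-sound m ts r)

leafSplits-complete  : ∀ {m t u} → Split m t u → u ∈ leafSplits m t
leafSplitsL-complete : ∀ {m ts us} → SplitL m ts us → us ∈ leafSplitsL m ts
leafSplits-complete at-leaf = here refl
leafSplits-complete (inside {l} s) = MP.∈-map⁺ (node l) (leafSplitsL-complete s)
leafSplitsL-complete (in-head {ts = ts} s) = MP.∈-++⁺ˡ (MP.∈-map⁺ (_∷ ts) (leafSplits-complete s))
leafSplitsL-complete {m} (in-tail {t} {ts} s) =
  MP.∈-++⁺ʳ (map (_∷ ts) (leafSplits m t)) (MP.∈-map⁺ (t ∷_) (leafSplitsL-complete s))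

split-leaves  : ∀ {m t u} → Split m t u → leaves u ≡ suc (leaves t)
splitL-leaves : ∀ {m ts us} → SplitL m ts us → leavesL us ≡ suc (leavesL ts)
split-leaves at-leaf = refl
split-leaves (inside s) = splitL-leaves s
splitL-leaves (in-head {ts = ts} s) = cong (_+ leavesL ts) (split-leaves s)
splitL-leaves (in-tail {t} s) = trans (cong (leaves t +_) (splitL-leaves s)) (+-suc _ _)

split-labels  : ∀ {m t u} → Split m t u → labels u ↭ m ∷ labels t
splitL-labels : ∀ {m ts us} → SplitL m ts us → labelsL us ↭ m ∷ labelsL ts
split-labels at-leaf = ↭-refl
split-labels {m} (inside {l} s) = ↭-trans (prep l (splitL-labels s)) (swap l m ↭-refl)
splitL-labels (in-head {ts = ts} s) = PP.++⁺ʳ (labelsL ts) (split-labels s)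
splitL-labels {m} (in-tail {t} {ts} s) =
  ↭-trans (PP.++⁺ˡ (labels t) (splitL-labels s)) (PP.shift m (labels t) (labelsL ts))

splitL-length : ∀ {m ts us} → SplitL m ts us → length us ≡ length ts
splitL-length (in-head s) = refl
splitL-length (in-tail s) = cong suc (splitL-length s)

split-rootDegree : ∀ {m l ts u} → Split m (node l ts) u → rootDegree u ≡ length ts
split-rootDegree (inside s) = splitL-length s

split-schroder  : ∀ {m t u} → Split m t u → Schroder t → Schroder u
splitL-schroder : ∀ {m ts us} → SplitL m ts us → All Schroder ts → All Schroder us
split-schroder at-leaf _ = node (s≤s (s≤s z≤n)) (leaf ∷ leaf ∷ [])
split-schroder (inside s) (node two ss) =
  node (subst (2 ≤_) (sym (splitL-length s)) two) (splitL-schroder s ss)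
splitL-schroder (in-head s) (t ∷ ts) = split-schroder s t ∷ ts
splitL-schroder (in-tail s) (t ∷ ts) = t ∷ splitL-schroder s ts

splitL-above : ∀ {l m ts us} → SplitL m ts us → l < m →
  All (LabelAbove l) ts → All (LabelAbove l) us
splitL-above (in-head at-leaf) l<m (_ ∷ as) = l<m ∷ as
splitL-above (in-head (inside s)) l<m (a ∷ as) = a ∷ as
splitL-above (in-tail s) l<m (a ∷ as) = a ∷ splitL-above s l<m as

split-increasing  : ∀ {m t u} → Split m t u → All (_< m) (labels t) → Increasing t → Increasing u
splitL-increasing : ∀ {m ts us} → SplitL m ts us → All (_< m) (labelsL ts) →
  All Increasing ts → All Increasing us
split-increasing at-leaf _ _ = node (tt ∷ tt ∷ []) (leaf ∷ leaf ∷ [])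
split-increasing (inside s) (l<m ∷ bounded) (node a i) =
  node (splitL-above s l<m a) (splitL-increasing s bounded i)
splitL-increasing (in-head {t} s) bounded (i ∷ is) =
  split-increasing s (AllP.++⁻ˡ (labels t) bounded) i ∷ is
splitL-increasing (in-tail {t} s) bounded (i ∷ is) =
  i ∷ splitL-increasing s (AllP.++⁻ʳ (labels t) bounded) is

leafSplits-length  : ∀ m t → length (leafSplits m t) ≡ leaves t
leafSplitsL-length : ∀ m ts → length (leafSplitsL m ts) ≡ leavesL ts
leafSplits-length m leaf = refl
leafSplits-length m (node l ts) = trans (LP.length-map (node l) (leafSplitsL m ts)) (leafSplitsL-length m ts)
leafSplitsL-length m [] = refl
leafSplitsL-length m (t ∷ ts) = begin
    length (map (_∷ ts) (leafSplits m t) ++ map (t ∷_) (leafSplitsL m ts))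
  ≡⟨ LP.length-++ (map (_∷ ts) (leafSplits m t)) ⟩
    length (map (_∷ ts) (leafSplits m t)) + length (map (t ∷_) (leafSplitsL m ts))
  ≡⟨ cong₂ _+_ (LP.length-map (_∷ ts) (leafSplits m t)) (LP.length-map (t ∷_) (leafSplitsL m ts)) ⟩
    length (leafSplits m t) + length (leafSplitsL m ts)
  ≡⟨ cong₂ _+_ (leafSplits-length m t) (leafSplitsL-length m ts) ⟩
    leaves t + leavesL ts ∎
  where open ≡-Reasoning

leafSplits-unique  : ∀ m t → Unique (leafSplits m t)
leafSplitsL-unique : ∀ m ts → Unique (leafSplitsL m ts)
leafSplits-unique m leaf = [] ∷ []
leafSplits-unique m (node l ts) = UP.map⁺ (λ { refl → refl }) (leafSplitsL-unique m ts)
leafSplitsL-unique m [] = []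
leafSplitsL-unique m (t ∷ ts) =
  UP.++⁺ (UP.map⁺ LP.∷-injectiveˡ (leafSplits-unique m t))
         (UP.map⁺ LP.∷-injectiveʳ (leafSplitsL-unique m ts)) disjoint
  where
    -- a split in the head changes the head, which a split in the tail keeps
    disjoint : ∀ {v} → ¬ (v ∈ map (_∷ ts) (leafSplits m t) × v ∈ map (t ∷_) (leafSplitsL m ts))
    disjoint (p , q) with MP.∈-map⁻ (_∷ ts) p | MP.∈-map⁻ (t ∷_) q
    ... | u , u∈ , refl | us , _ , e =
      1+n≢n (trans (sym (split-leaves (leafSplits-sound m t u∈))) (cong leaves (LP.∷-injectiveˡ e)))

-- Adding a leaf below a given label.

addLeaf  : ℕ → Tree → Tree
addLeafL : ℕ → List Tree → List Tree
addLeaf m leaf = leaf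
addLeaf m (node l ts) with l ≟ m
... | yes _ = node l (leaf ∷ ts)
... | no _  = node l (addLeafL m ts)
addLeafL m [] = []
addLeafL m (t ∷ ts) = addLeaf m t ∷ addLeafL m ts

addLeaf-hit : ∀ m ts → addLeaf m (node m ts) ≡ node m (leaf ∷ ts)
addLeaf-hit m ts with m ≟ m
... | yes _ = refl
... | no m≢m = ⊥-elim (m≢m refl)

addLeaf-miss : ∀ {l m} ts → l ≢ m → addLeaf m (node l ts) ≡ node l (addLeafL m ts)
addLeaf-miss {l} {m} ts l≢m with l ≟ m
... | yes l≡m = ⊥-elim (l≢m l≡m)
... | no _ = refl

addLeaf-absent  : ∀ m t → m ∉ labels t → addLeaf m t ≡ t
addLeafL-absent : ∀ m ts → m ∉ labelsL ts → addLeafL m ts ≡ ts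
addLeaf-absent m leaf _ = refl
addLeaf-absent m (node l ts) m∉ with l ≟ m
... | yes refl = ⊥-elim (m∉ (here refl))
... | no _ = cong (node l) (addLeafL-absent m ts (λ p → m∉ (there p)))
addLeafL-absent m [] _ = refl
addLeafL-absent m (t ∷ ts) m∉ =
  cong₂ _∷_ (addLeaf-absent m t (λ p → m∉ (MP.∈-++⁺ˡ p)))
            (addLeafL-absent m ts (λ p → m∉ (MP.∈-++⁺ʳ (labels t) p)))

addLeaf-labels  : ∀ m t → labels (addLeaf m t) ≡ labels t
addLeafL-labels : ∀ m ts → labelsL (addLeafL m ts) ≡ labelsL ts
addLeaf-labels m leaf = refl
addLeaf-labels m (node l ts) with l ≟ m
... | yes _ = refl
... | no _ = cong (l ∷_) (addLeafL-labels m ts)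
addLeafL-labels m [] = refl
addLeafL-labels m (t ∷ ts) = cong₂ _++_ (addLeaf-labels m t) (addLeafL-labels m ts)

length-addLeafL : ∀ m ts → length (addLeafL m ts) ≡ length ts
length-addLeafL m [] = refl
length-addLeafL m (t ∷ ts) = cong suc (length-addLeafL m ts)

addLeaf-leaves  : ∀ m t → m ∈ labels t → Unique (labels t) → leaves (addLeaf m t) ≡ suc (leaves t)
addLeafL-leaves : ∀ m ts → m ∈ labelsL ts → Unique (labelsL ts) →
  leavesL (addLeafL m ts) ≡ suc (leavesL ts)
addLeaf-leaves m leaf () _
addLeaf-leaves m (node l ts) m∈ (_ ∷ u) with l ≟ m
... | yes _ = refl
... | no l≢m with m∈
...   | here m≡l = ⊥-elim (l≢m (sym m≡l))
...   | there m∈ts = addLeafL-leaves m ts m∈ts u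
addLeafL-leaves m (t ∷ ts) m∈ u with unique-++⁻ {xs = labels t} u | MP.∈-++⁻ (labels t) m∈
... | ut , _ , disjoint | inj₁ m∈t =
  cong₂ _+_ (addLeaf-leaves m t m∈t ut) (cong leavesL (addLeafL-absent m ts (disjoint m∈t)))
... | _ , uts , disjoint | inj₂ m∈ts =
  trans (cong₂ _+_ (cong leaves (addLeaf-absent m t (λ m∈t → disjoint m∈t m∈ts)))
                   (addLeafL-leaves m ts m∈ts uts))
        (+-suc _ _)

addLeaf-above : ∀ {l} m t → LabelAbove l t → LabelAbove l (addLeaf m t)
addLeaf-above m leaf a = tt
addLeaf-above m (node l' ts) a with l' ≟ m
... | yes _ = a
... | no _ = a

addLeafL-above : ∀ {l} m ts → All (LabelAbove l) ts → All (LabelAbove l) (addLeafL m ts)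
addLeafL-above m [] [] = []
addLeafL-above m (t ∷ ts) (a ∷ as) = addLeaf-above m t a ∷ addLeafL-above m ts as

addLeaf-schroder  : ∀ m t → Schroder t → Schroder (addLeaf m t)
addLeafL-schroder : ∀ m ts → All Schroder ts → All Schroder (addLeafL m ts)
addLeaf-schroder m leaf s = leaf
addLeaf-schroder m (node l ts) (node two s) with l ≟ m
... | yes _ = node (≤-trans two (n≤1+n _)) (leaf ∷ s)
... | no _ = node (subst (2 ≤_) (sym (length-addLeafL m ts)) two) (addLeafL-schroder m ts s)
addLeafL-schroder m [] [] = []
addLeafL-schroder m (t ∷ ts) (s ∷ ss) = addLeaf-schroder m t s ∷ addLeafL-schroder m ts ss

addLeaf-increasing  : ∀ m t → Increasing t → Increasing (addLeaf m t)
addLeafL-increasing : ∀ m ts → All Increasing ts → All Increasing (addLeafL m ts)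
addLeaf-increasing m leaf i = leaf
addLeaf-increasing m (node l ts) (node a i) with l ≟ m
... | yes _ = node (tt ∷ a) (leaf ∷ i)
... | no _ = node (addLeafL-above m ts a) (addLeafL-increasing m ts i)
addLeafL-increasing m [] [] = []
addLeafL-increasing m (t ∷ ts) (i ∷ is) = addLeaf-increasing m t i ∷ addLeafL-increasing m ts is

-- Removing a leaf below a given label.

-- dropFirstChild l ts: the node l with its first child removed; a node left
-- with a single child (a leaf, in the intended use) becomes that leaf.
dropFirstChild : ℕ → List Tree → Tree
dropFirstChild l (_ ∷ _ ∷ []) = leaf
dropFirstChild l (_ ∷ ts) = node l ts
dropFirstChild l [] = node l []

removeLeaf  : ℕ → Tree → Tree
removeLeafL : ℕ → List Tree → List Tree
removeLeaf m leaf = leaf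
removeLeaf m (node l ts) with l ≟ m
... | yes _ = dropFirstChild l ts
... | no _  = node l (removeLeafL m ts)
removeLeafL m [] = []
removeLeafL m (t ∷ ts) = removeLeaf m t ∷ removeLeafL m ts

removeLeaf-hit : ∀ m ts → removeLeaf m (node m ts) ≡ dropFirstChild m ts
removeLeaf-hit m ts with m ≟ m
... | yes _ = refl
... | no m≢m = ⊥-elim (m≢m refl)

removeLeaf-miss : ∀ {l m} ts → l ≢ m → removeLeaf m (node l ts) ≡ node l (removeLeafL m ts)
removeLeaf-miss {l} {m} ts l≢m with l ≟ m
... | yes l≡m = ⊥-elim (l≢m l≡m)
... | no _ = refl

removeLeaf-absent  : ∀ m t → m ∉ labels t → removeLeaf m t ≡ t
removeLeafL-absent : ∀ m ts → m ∉ labelsL ts → removeLeafL m ts ≡ ts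
removeLeaf-absent m leaf _ = refl
removeLeaf-absent m (node l ts) m∉ with l ≟ m
... | yes refl = ⊥-elim (m∉ (here refl))
... | no _ = cong (node l) (removeLeafL-absent m ts (λ p → m∉ (there p)))
removeLeafL-absent m [] _ = refl
removeLeafL-absent m (t ∷ ts) m∉ =
  cong₂ _∷_ (removeLeaf-absent m t (λ p → m∉ (MP.∈-++⁺ˡ p)))
            (removeLeafL-absent m ts (λ p → m∉ (MP.∈-++⁺ʳ (labels t) p)))

length-removeLeafL : ∀ m ts → length (removeLeafL m ts) ≡ length ts
length-removeLeafL m [] = refl
length-removeLeafL m (t ∷ ts) = cong suc (length-removeLeafL m ts)

dropFirstChild-schroder : ∀ l ts → 2 ≤ length ts → All Schroder ts → Schroder (dropFirstChild l ts)
dropFirstChild-schroder l (_ ∷ _ ∷ []) _ _ = leaf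
dropFirstChild-schroder l (_ ∷ _ ∷ _ ∷ _) _ (_ ∷ s) = node (s≤s (s≤s z≤n)) s
dropFirstChild-schroder l (_ ∷ []) (s≤s ()) _

removeLeaf-schroder  : ∀ m t → Schroder t → Schroder (removeLeaf m t)
removeLeafL-schroder : ∀ m ts → All Schroder ts → All Schroder (removeLeafL m ts)
removeLeaf-schroder m leaf s = leaf
removeLeaf-schroder m (node l ts) (node two s) with l ≟ m
... | yes _ = dropFirstChild-schroder l ts two s
... | no _ = node (subst (2 ≤_) (sym (length-removeLeafL m ts)) two) (removeLeafL-schroder m ts s)
removeLeafL-schroder m [] [] = []
removeLeafL-schroder m (t ∷ ts) (s ∷ ss) = removeLeaf-schroder m t s ∷ removeLeafL-schroder m ts ss

dropFirstChild-above : ∀ {l l'} ts → l < l' → LabelAbove l (dropFirstChild l' ts)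
dropFirstChild-above (_ ∷ _ ∷ []) _ = tt
dropFirstChild-above (_ ∷ _ ∷ _ ∷ _) l<l' = l<l'
dropFirstChild-above (_ ∷ []) l<l' = l<l'
dropFirstChild-above [] l<l' = l<l'

removeLeaf-above : ∀ {l} m t → LabelAbove l t → LabelAbove l (removeLeaf m t)
removeLeaf-above m leaf a = tt
removeLeaf-above m (node l' ts) a with l' ≟ m
... | yes _ = dropFirstChild-above ts a
... | no _ = a

removeLeafL-above : ∀ {l} m ts → All (LabelAbove l) ts → All (LabelAbove l) (removeLeafL m ts)
removeLeafL-above m [] [] = []
removeLeafL-above m (t ∷ ts) (a ∷ as) = removeLeaf-above m t a ∷ removeLeafL-above m ts as

dropFirstChild-increasing : ∀ l ts → All (LabelAbove l) ts → All Increasing ts →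
  Increasing (dropFirstChild l ts)
dropFirstChild-increasing l (_ ∷ _ ∷ []) _ _ = leaf
dropFirstChild-increasing l (_ ∷ _ ∷ _ ∷ _) (_ ∷ a) (_ ∷ i) = node a i
dropFirstChild-increasing l (_ ∷ []) _ _ = node [] []
dropFirstChild-increasing l [] _ _ = node [] []

removeLeaf-increasing  : ∀ m t → Increasing t → Increasing (removeLeaf m t)
removeLeafL-increasing : ∀ m ts → All Increasing ts → All Increasing (removeLeafL m ts)
removeLeaf-increasing m leaf i = leaf
removeLeaf-increasing m (node l ts) (node a i) with l ≟ m
... | yes _ = dropFirstChild-increasing l ts a i
... | no _ = node (removeLeafL-above m ts a) (removeLeafL-increasing m ts i)
removeLeafL-increasing m [] [] = []
removeLeafL-increasing m (t ∷ ts) (i ∷ is) = removeLeaf-increasing m t i ∷ removeLeafL-increasing m ts is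

dropFirstChild-leaf : ∀ l ts → 2 ≤ length ts → dropFirstChild l (leaf ∷ ts) ≡ node l ts
dropFirstChild-leaf l (_ ∷ _ ∷ _) _ = refl
dropFirstChild-leaf l (_ ∷ []) (s≤s ())

removeLeaf-addLeaf  : ∀ m t → Schroder t → removeLeaf m (addLeaf m t) ≡ t
removeLeafL-addLeafL : ∀ m ts → All Schroder ts → removeLeafL m (addLeafL m ts) ≡ ts
removeLeaf-addLeaf m leaf _ = refl
removeLeaf-addLeaf m (node l ts) (node two s) with l ≟ m
... | yes refl = trans (removeLeaf-hit l (leaf ∷ ts)) (dropFirstChild-leaf l ts two)
... | no l≢m = trans (removeLeaf-miss (addLeafL m ts) l≢m) (cong (node l) (removeLeafL-addLeafL m ts s))
removeLeafL-addLeafL m [] [] = refl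
removeLeafL-addLeafL m (t ∷ ts) (s ∷ ss) = cong₂ _∷_ (removeLeaf-addLeaf m t s) (removeLeafL-addLeafL m ts ss)

removeLeaf-split  : ∀ {m t u} → Split m t u → m ∉ labels t → removeLeaf m u ≡ t
removeLeafL-splitL : ∀ {m ts us} → SplitL m ts us → m ∉ labelsL ts → removeLeafL m us ≡ ts
removeLeaf-split {m} at-leaf _ = removeLeaf-hit m (leaf ∷ leaf ∷ [])
removeLeaf-split (inside {l} {us = us} s) m∉ =
  trans (removeLeaf-miss us (λ l≡m → m∉ (here (sym l≡m))))
        (cong (node l) (removeLeafL-splitL s (λ p → m∉ (there p))))
removeLeafL-splitL {m} (in-head {t} {ts = ts} s) m∉ =
  cong₂ _∷_ (removeLeaf-split s (λ p → m∉ (MP.∈-++⁺ˡ p)))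
            (removeLeafL-absent m ts (λ p → m∉ (MP.∈-++⁺ʳ (labels t) p)))
removeLeafL-splitL {m} (in-tail {t} s) m∉ =
  cong₂ _∷_ (removeLeaf-absent m t (λ p → m∉ (MP.∈-++⁺ˡ p)))
            (removeLeafL-splitL s (λ p → m∉ (MP.∈-++⁺ʳ (labels t) p)))

-- Let M be the largest label of an increasing Schröder tree u, occurring once.
-- The node M has only leaf children, so u is recovered from removeLeaf M u
-- either by adding a leaf below M (if the node M had at least three children)
-- or by splitting a leaf with label M (if it had exactly two).
Regrows : ℕ → Tree → Set
Regrows M u = u ≡ addLeaf M (removeLeaf M u) ⊎ Split M (removeLeaf M u) u

RegrowsL : ℕ → List Tree → Set
RegrowsL M us = us ≡ addLeafL M (removeLeafL M us) ⊎ SplitL M (removeLeafL M us) us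

regrow-leafNode : ∀ l ts → 2 ≤ length ts → All (_≡ leaf) ts →
  node l ts ≡ addLeaf l (dropFirstChild l ts) ⊎ Split l (dropFirstChild l ts) (node l ts)
regrow-leafNode l (_ ∷ _ ∷ []) _ (refl ∷ refl ∷ []) = inj₂ at-leaf
regrow-leafNode l (_ ∷ b ∷ c ∷ r) _ (refl ∷ _) = inj₁ (sym (addLeaf-hit l (b ∷ c ∷ r)))
regrow-leafNode l (_ ∷ []) (s≤s ()) _

removeMax-regrows  : ∀ M u → Schroder u → Increasing u → All (_≤ M) (labels u) →
  M ∈ labels u → Unique (labels u) → Regrows M u
removeMaxL-regrows : ∀ M us → All Schroder us → All Increasing us → All (_≤ M) (labelsL us) →
  M ∈ labelsL us → Unique (labelsL us) → RegrowsL M us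
removeMax-regrows M leaf _ _ _ () _
removeMax-regrows M (node l ts) (node two s) (node a i) (_ ∷ bounded) M∈ (_ ∷ u) with l ≟ M
... | yes refl = regrow-leafNode l ts two (children-of-max ts a bounded)
... | no l≢M with M∈
...   | here M≡l = ⊥-elim (l≢M (sym M≡l))
...   | there M∈ts with removeMaxL-regrows M ts s i bounded M∈ts u
...     | inj₁ e = inj₁ (trans (cong (node l) e) (sym (addLeaf-miss _ l≢M)))
...     | inj₂ sp = inj₂ (inside sp)
removeMaxL-regrows M (c ∷ cs) (s ∷ ss) (i ∷ is) bounded M∈ u
  with unique-++⁻ {xs = labels c} u | MP.∈-++⁻ (labels c) M∈
... | uc , _ , disjoint | inj₁ M∈c
  rewrite removeLeafL-absent M cs (disjoint M∈c)
  with removeMax-regrows M c s i (AllP.++⁻ˡ (labels c) bounded) M∈c uc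
...   | inj₁ e = inj₁ (cong₂ _∷_ e (sym (addLeafL-absent M cs (disjoint M∈c))))
...   | inj₂ sp = inj₂ (in-head sp)
removeMaxL-regrows M (c ∷ cs) (s ∷ ss) (i ∷ is) bounded M∈ u
  | _ , ucs , disjoint | inj₂ M∈cs
  rewrite removeLeaf-absent M c (λ M∈c → disjoint M∈c M∈cs)
  with removeMaxL-regrows M cs ss is (AllP.++⁻ʳ (labels c) bounded) M∈cs ucs
...   | inj₁ e = inj₁ (cong₂ _∷_ (sym (addLeaf-absent M c (λ M∈c → disjoint M∈c M∈cs))) e)
...   | inj₂ sp = inj₂ (in-tail sp)

-- Children and parents.

-- The number of internal nodes; for an SIS tree it is the largest label.
internalCount : Tree → ℕ
internalCount t = length (labels t)

data IsChild (t : Tree) : Tree → Set where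
  added : IsChild t (addLeaf (internalCount t) t)
  split : ∀ {u} → Split (suc (internalCount t)) t u → IsChild t u

children : Tree → List Tree
children t = addLeaf (internalCount t) t ∷ leafSplits (suc (internalCount t)) t

children-sound : ∀ t {u} → u ∈ children t → IsChild t u
children-sound t (here refl) = added
children-sound t (there p) = split (leafSplits-sound _ t p)

children-complete : ∀ {t u} → IsChild t u → u ∈ children t
children-complete added = here refl
children-complete (split sp) = there (leafSplits-complete sp)

children-length : ∀ t → length (children t) ≡ suc (leaves t)
children-length t = cong suc (leafSplits-length _ t)

-- The children of an SIS tree are distinct: a split child contains the label
-- ℓ + 1, which the added child does not.
children-unique : ∀ t → StronglyIncreasingSchroder t → Unique (children t)
children-unique t (_ , _ , o) = All.tabulate added≢split ∷ leafSplits-unique _ t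
  where
    ℓ : ℕ
    ℓ = internalCount t
    added≢split : ∀ {u} → u ∈ leafSplits (suc ℓ) t → addLeaf ℓ t ≢ u
    added≢split p refl = oneTo-fresh o (subst (suc ℓ ∈_) (addLeaf-labels ℓ t)
      (PP.∈-resp-↭ (↭-sym (split-labels (leafSplits-sound _ t p))) (here refl)))

split-SIS : ∀ {t u} → StronglyIncreasingSchroder t → Split (suc (internalCount t)) t u →
  StronglyIncreasingSchroder u × leaves u ≡ suc (leaves t)
split-SIS (s , i , o) sp =
  (split-schroder sp s , split-increasing sp (All.map s≤s (oneTo-bounded o)) i ,
   oneTo-add-next (split-labels sp) o) ,
  split-leaves sp

added-SIS : ∀ r ts → StronglyIncreasingSchroder (node r ts) → leavesL ts ≢ length ts →
  let t = node r ts; ℓ = internalCount t in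
  StronglyIncreasingSchroder (addLeaf ℓ t) × leaves (addLeaf ℓ t) ≡ suc (leavesL ts) ×
  rootDegree (addLeaf ℓ t) ≡ length ts
added-SIS r ts (s , i , o) nonflat =
  (addLeaf-schroder ℓ t s , addLeaf-increasing ℓ t i , subst OneTo (sym (addLeaf-labels ℓ t)) o) ,
  addLeaf-leaves ℓ t (oneTo-max o) (oneTo-unique o) ,
  trans (cong rootDegree (addLeaf-miss ts (root-not-max r ts (s , i , o) nonflat))) (length-addLeafL ℓ ts)
  where
    t : Tree
    t = node r ts
    ℓ : ℕ
    ℓ = internalCount t

child-SIS : ∀ {n k t u} → 1 ≤ k → n ≢ k → SISTree n k t → IsChild t u → SISTree (suc n) k u
child-SIS {t = leaf} () _ (_ , _ , refl) _
child-SIS {t = node r ts} _ nonflat (sis , refl , refl) added = added-SIS r ts sis nonflat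
child-SIS {t = node r ts} _ _ (sis , refl , refl) (split sp) =
  let sis' , leaves' = split-SIS sis sp in sis' , leaves' , split-rootDegree sp

parent : Tree → Tree
parent u = removeLeaf (internalCount u) u

parent-of-child : ∀ t {u} → StronglyIncreasingSchroder t → IsChild t u → parent u ≡ t
parent-of-child t (s , _ , _) added =
  subst (λ m → removeLeaf m (addLeaf ℓ t) ≡ t) (sym (cong length (addLeaf-labels ℓ t)))
        (removeLeaf-addLeaf ℓ t s)
  where
    ℓ : ℕ
    ℓ = internalCount t
parent-of-child t {u} (_ , _ , o) (split sp) =
  subst (λ m → removeLeaf m u ≡ t) (sym (PP.↭-length (split-labels sp)))
        (removeLeaf-split sp (oneTo-fresh o))

regrown-child : ∀ {r us t} → let u = node r us in OneTo (labels u) →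
  u ≡ addLeaf (internalCount u) t ⊎ Split (internalCount u) t u →
  OneTo (labels t) × suc (leaves t) ≡ leaves u × IsChild t u
regrown-child {r} {us} {t} o (inj₁ e) =
  subst OneTo (sym same) o ,
  sym (trans (cong leaves e) (addLeaf-leaves M t (subst (M ∈_) (sym same) (oneTo-max o))
                                                 (subst Unique (sym same) (oneTo-unique o)))) ,
  subst (IsChild t) (sym (trans e (cong (λ m → addLeaf m t) (cong length (sym same))))) added
  where
    M : ℕ
    M = internalCount (node r us)
    same : labels t ≡ labels (node r us)
    same = trans (sym (addLeaf-labels M t)) (cong labels (sym e))
regrown-child {r} {us} {t} o (inj₂ sp) =
  oneTo-remove-max (split-labels sp) o ,
  sym (split-leaves sp) ,
  split (subst (λ m → Split m t (node r us)) (PP.↭-length (split-labels sp)) sp)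

parent-SIS : ∀ r us → let u = node r us in
  StronglyIncreasingSchroder u → leavesL us ≢ length us →
  StronglyIncreasingSchroder (parent u) × suc (leaves (parent u)) ≡ leavesL us ×
  rootDegree (parent u) ≡ length us × IsChild (parent u) u
parent-SIS r us (s , i , o) nonflat =
  (removeLeaf-schroder M u s , removeLeaf-increasing M u i , proj₁ regrown) ,
  proj₁ (proj₂ regrown) , degree , proj₂ (proj₂ regrown)
  where
    u : Tree
    u = node r us
    M : ℕ
    M = internalCount u
    regrown : OneTo (labels (parent u)) × suc (leaves (parent u)) ≡ leaves u × IsChild (parent u) u
    regrown = regrown-child o
      (removeMax-regrows M u s i (oneTo-bounded o) (oneTo-max o) (oneTo-unique o))
    degree : rootDegree (parent u) ≡ length us
    degree = trans (cong rootDegree (removeLeaf-miss us (root-not-max r us (s , i , o) nonflat)))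
                   (length-removeLeafL M us)

parent-SISTree : ∀ {n k u} → 1 ≤ k → suc n ≢ k → SISTree (suc n) k u →
  SISTree n k (parent u) × IsChild (parent u) u
parent-SISTree {u = leaf} () _ (_ , _ , refl)
parent-SISTree {u = node r us} _ nonflat (sis , lv , refl) =
  let sis' , lv' , degree , child = parent-SIS r us sis (λ e → nonflat (trans (sym lv) e))
  in (sis' , suc-injective (trans lv' lv) , degree) , child

-- The generations of trees with root degree k.

internalCount-flat : ∀ k → internalCount (flat k) ≡ 1
internalCount-flat k = cong (λ ls → suc (length ls)) (labelsL-leaves k)

SISTree-flat : ∀ {k t} → SISTree k k t → t ≡ flat k
SISTree-flat {t = leaf} (_ , () , refl)
SISTree-flat {t = node r ts} (sis , lv , refl) = SIS-flat r ts sis lv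

-- The children of flat k with root degree k are its leaf splits (the added
-- child has root degree k + 1).
flat-child : ∀ k {u} → IsChild (flat k) u → rootDegree u ≡ k → u ∈ leafSplits 2 (flat k)
flat-child k added degree = ⊥-elim (1+n≢n (trans (sym added-degree) degree))
  where
    open ≡-Reasoning
    added-degree : rootDegree (addLeaf (internalCount (flat k)) (flat k)) ≡ suc k
    added-degree = begin
        rootDegree (addLeaf (internalCount (flat k)) (flat k))
      ≡⟨ cong (λ m → rootDegree (addLeaf m (flat k))) (internalCount-flat k) ⟩
        rootDegree (addLeaf 1 (flat k))
      ≡⟨ cong rootDegree (addLeaf-hit 1 (replicate k leaf)) ⟩
        suc (length (replicate k leaf))
      ≡⟨ cong suc (LP.length-replicate k) ⟩
        suc k ∎
flat-child k {u} (split sp) _ =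
  leafSplits-complete (subst (λ m → Split m (flat k) u) (cong suc (internalCount-flat k)) sp)

-- generation k j lists the SIS trees with k + 1 + j leaves and root degree k:
-- the leaf splits of the flat tree, then the children of the previous
-- generation.
generation : ℕ → ℕ → List Tree
generation k zero = leafSplits 2 (flat k)
generation k (suc j) = concatMap children (generation k j)

-- Trees of generation j have more leaves than root children, so are not flat.
not-flat : ∀ k j → suc (k + j) ≢ k
not-flat k j = ≢-sym (m≢1+m+n k)

generation-sound : ∀ k j → 2 ≤ k → ∀ {u} → u ∈ generation k j → SISTree (suc (k + j)) k u
generation-sound k zero two {u} p =
  proj₁ facts ,
  trans (proj₂ facts) (cong suc (trans (leavesL-leaves k) (sym (+-identityʳ k)))) ,
  trans (split-rootDegree sp) (LP.length-replicate k)
  where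
    sp : Split (suc (internalCount (flat k))) (flat k) u
    sp = subst (λ m → Split m (flat k) u) (cong suc (sym (internalCount-flat k)))
               (leafSplits-sound 2 (flat k) p)
    facts : StronglyIncreasingSchroder u × leaves u ≡ suc (leaves (flat k))
    facts = split-SIS (flat-SIS k two) sp
generation-sound k (suc j) two {u} p with find (MP.∈-concatMap⁻ children p)
... | t , t∈ , u∈ =
  subst (λ n → SISTree n k u) (cong suc (sym (+-suc k j)))
    (child-SIS (<⇒≤ two) (not-flat k j)
               (generation-sound k j two t∈) (children-sound t u∈))

generation-complete : ∀ k j → 2 ≤ k → ∀ {u} → SISTree (suc (k + j)) k u → u ∈ generation k j
generation-complete k zero two {u} sis@(_ , _ , degree) =
  flat-child k (subst (λ t → IsChild t u) (SISTree-flat parentSIS) child) degree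
  where
    parent-facts : SISTree (k + 0) k (parent u) × IsChild (parent u) u
    parent-facts = parent-SISTree (<⇒≤ two) (not-flat k 0) sis
    parentSIS : SISTree k k (parent u)
    parentSIS = subst (λ n → SISTree n k (parent u)) (+-identityʳ k) (proj₁ parent-facts)
    child : IsChild (parent u) u
    child = proj₂ parent-facts
generation-complete k (suc j) two {u} sis =
  MP.∈-concatMap⁺ children (lose t∈ (children-complete child))
  where
    parent-facts : SISTree (k + suc j) k (parent u) × IsChild (parent u) u
    parent-facts = parent-SISTree (<⇒≤ two) (not-flat k (suc j)) sis
    child : IsChild (parent u) u
    child = proj₂ parent-facts
    t∈ : parent u ∈ generation k j
    t∈ = generation-complete k j two (subst (λ n → SISTree n k (parent u)) (+-suc k j) (proj₁ parent-facts))

-- Distinct trees have distinct children, since the parent recovers the tree.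
generation-unique : ∀ k j → 2 ≤ k → Unique (generation k j)
generation-unique k zero two = leafSplits-unique 2 (flat k)
generation-unique k (suc j) two =
  unique-concatMap StronglyIncreasingSchroder children parent (generation k j)
    (generation-unique k j two)
    (All.tabulate (λ p → proj₁ (generation-sound k j two p)))
    (λ {t} sis → children-unique t sis)
    (λ {t} sis u∈ → parent-of-child t sis (children-sound t u∈))

-- Generation 0 has k trees, and each tree of generation j has k + j + 2
-- children, so |generation k j| · (k+1)! = (k+1+j)! · k.
generation-length : ∀ k j → 2 ≤ k → length (generation k j) * (suc k) ! ≡ (suc (k + j)) ! * k
generation-length k zero two = begin
    length (leafSplits 2 (flat k)) * (suc k) !
  ≡⟨ cong (_* (suc k) !) (trans (leafSplits-length 2 (flat k)) (leavesL-leaves k)) ⟩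
    k * (suc k) !
  ≡⟨ *-comm k _ ⟩
    (suc k) ! * k
  ≡⟨ cong (λ z → (suc z) ! * k) (sym (+-identityʳ k)) ⟩
    (suc (k + 0)) ! * k ∎
  where open ≡-Reasoning
generation-length k (suc j) two = begin
    length (concatMap children (generation k j)) * F
  ≡⟨ cong (_* F) (length-concatMap children (generation k j) c childCount) ⟩
    (A * c) * F
  ≡⟨ cong (_* F) (*-comm A c) ⟩
    (c * A) * F
  ≡⟨ *-assoc c A F ⟩
    c * (A * F)
  ≡⟨ cong (c *_) (generation-length k j two) ⟩
    c * ((suc (k + j)) ! * k)
  ≡⟨ sym (*-assoc c ((suc (k + j)) !) k) ⟩
    (suc (suc (k + j))) ! * k
  ≡⟨ cong (λ z → (suc z) ! * k) (sym (+-suc k j)) ⟩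
    (suc (k + suc j)) ! * k ∎
  where
    open ≡-Reasoning
    F A c : ℕ
    F = (suc k) !
    A = length (generation k j)
    c = suc (suc (k + j))
    childCount : ∀ {t} → t ∈ generation k j → length (children t) ≡ c
    childCount {t} p = trans (children-length t) (cong suc (proj₁ (proj₂ (generation-sound k j two p))))

corollary2 : (n k : ℕ) → 2 ≤ n → 2 ≤ k → k < n →
    Σ ℕ λ t → HasCount (SISTree n k) t × t * (suc k) ! ≡ n ! * k
corollary2 n k _ two k<n with m≤n⇒∃[o]m+o≡n k<n
... | j , refl =
  length (generation k j) ,
  (generation k j , generation-unique k j two ,
   (λ u → mk⇔ (generation-sound k j two) (generation-complete k j two)) , refl) ,
  generation-length k j two
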